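{- Let \(\vec G\) be an oriented graph with a vertex \(v\) of degree \(2\) (in the underlying graph). If \(\vec G\) is complete convex, then \(\vec G-v\) is complete convex.
   Context: Oriented graphs: anti-symmetric digraphs without parallel arcs. A \(2\)-dipath \(u,v,w\) with centre \(v\): \(uv,vw\) arcs, \(u\ne v\ne w\). A vertex set \(S\) is convex if no vertex outside \(S\) is the centre of a \(2\)-dipath with both ends in \(S\); \(conv(S)\) is the smallest convex superset of \(S\). An oriented graph is complete convex if \(conv(\{u,v\})\) is the whole vertex set for every arc \(uv\). -}

module Defs where

open import Data.Nat using (ℕ; suc)
open import Data.Fin using (Fin; punchIn)
open import Data.Fin.Properties using (punchIn-injective)
open import Data.Fin.Subset using (Subset; _∈_; _∉_; _⊆_; ⁅_⁆; _∪_; ∣_∣)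
open import Data.Bool using (_∨_)
open import Data.Vec using (tabulate)
open import Data.Product using (_×_; _,_)
open import Data.Empty using (⊥)
open import Relation.Nullary using (¬_)
open import Relation.Nullary.Decidable using (⌊_⌋)
open import Relation.Binary using (Rel; Decidable)

record Oriented (n : ℕ) : Set₁ where
  field
    Arc     : Rel (Fin n) _
    arc?    : Decidable Arc
    irrefl  : ∀ u → ¬ Arc u u
    antisym : ∀ u v → Arc u v → ¬ Arc v u
open Oriented public

neighbours : ∀ {n} → Oriented n → Fin n → Subset n
neighbours G v = tabulate (λ w → ⌊ arc? G v w ⌋ ∨ ⌊ arc? G w v ⌋)

degree : ∀ {n} → Oriented n → Fin n → ℕ
degree G v = ∣ neighbours G v ∣

Convex : ∀ {n} → Oriented n → Subset n → Set
Convex G S = ∀ u x w → u ∈ S → w ∈ S → x ∉ S →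
             ¬ (Arc G u x × Arc G x w)

InConv : ∀ {n} → Oriented n → Subset n → Fin n → Set
InConv G S x = ∀ T → Convex G T → S ⊆ T → x ∈ T

CompleteConvex : ∀ {n} → Oriented n → Set
CompleteConvex G = ∀ u v → Arc G u v → ∀ x → InConv G (⁅ u ⁆ ∪ ⁅ v ⁆) x

delete : ∀ {n} → Oriented (suc n) → Fin (suc n) → Oriented n
delete G v = record
  { Arc     = λ x y → Arc G (punchIn v x) (punchIn v y)
  ; arc?    = λ x y → arc? G (punchIn v x) (punchIn v y)
  ; irrefl  = λ x → irrefl G (punchIn v x)
  ; antisym = λ x y → antisym G (punchIn v x) (punchIn v y)
  }

-- Let T be convex in G − v.  Put v into T exactly when all neighbours of v lie
-- in T.  The resulting set is convex in G: a 2-dipath avoiding v is excluded by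
-- the convexity of T, one ending at v has its centre among the neighbours of v,
-- and one centred at v, say u → v → w, has u ≠ w by anti-symmetry, so that
-- {u, w} is the whole neighbourhood of v because v has degree 2.  Since the hull
-- of every arc of G is everything, this convex set of G, which contains the
-- ends of a given arc of G − v, is all of V(G); hence T is all of V(G − v).
module Submission where

open import Defs
open import Data.Nat using (ℕ; suc; _≤_; z≤n; s≤s)
open import Data.Nat.Properties using (module ≤-Reasoning)
open import Data.Fin using (Fin; punchIn; punchOut; _≟_)
open import Data.Fin.Properties using (punchIn-punchOut; punchIn-injective; all?)
open import Data.Fin.Subset using (Subset; _∈_; _∉_; _⊆_; ⁅_⁆; _∪_; ∣_∣; _-_)
open import Data.Fin.Subset.Properties
  using (_∈?_; x∈p⇒∣p-x∣<∣p∣; x∈p∧x≢y⇒x∈p-y; x∈⁅y⁆⇒x≡y; x∈⁅x⁆; x∈p∪q⁻; x∈p∪q⁺)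
open import Data.Bool using (Bool; true; false; _∨_)
open import Data.Vec using (lookup; insertAt)
open import Data.Vec.Properties
  using (lookup∘tabulate; insertAt-punchIn; insertAt-lookup; []=⇒lookup; lookup⇒[]=)
open import Data.Product using (_×_; _,_; ∃; ∃₂)
open import Data.Sum using (_⊎_; inj₁; inj₂)
open import Data.Empty using (⊥; ⊥-elim)
open import Relation.Nullary using (¬_; yes; no; Dec)
open import Relation.Nullary.Decidable using (⌊_⌋; _→-dec_; _⊎-dec_)
open import Relation.Binary.PropositionalEquality
  using (_≡_; _≢_; refl; sym; trans; subst)

private
  variable
    n : ℕ

Adjacent : Oriented n → Fin n → Fin n → Set
Adjacent G u w = Arc G u w ⊎ Arc G w u

adjacent? : (G : Oriented n) → ∀ u w → Dec (Adjacent G u w)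
adjacent? G u w = arc? G u w ⊎-dec arc? G w u

adjacent⇒∈neighbours : (G : Oriented n) → ∀ {v w} → Adjacent G v w → w ∈ neighbours G v
adjacent⇒∈neighbours G {v} {w} adj =
  lookup⇒[]= w (neighbours G v) (trans (lookup∘tabulate _ w) (∨-true (arc? G v w) (arc? G w v) adj))
  where
  ∨-true : ∀ {A B : Set} (a : Dec A) (b : Dec B) → A ⊎ B → (⌊ a ⌋ ∨ ⌊ b ⌋) ≡ true
  ∨-true (yes _) _       _       = refl
  ∨-true (no _)  (yes _) _       = refl
  ∨-true (no ¬a) (no _)  (inj₁ a) = ⊥-elim (¬a a)
  ∨-true (no _)  (no ¬b) (inj₂ b) = ⊥-elim (¬b b)

∣p∣≡2⇒∈-cases : ∀ {S : Subset n} {a b c} → ∣ S ∣ ≡ 2 → a ∈ S → b ∈ S → a ≢ b →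
                c ∈ S → c ≡ a ⊎ c ≡ b
∣p∣≡2⇒∈-cases {S = S} {a} {b} {c} ∣S∣≡2 a∈S b∈S a≢b c∈S with c ≟ a | c ≟ b
... | yes c≡a | _       = inj₁ c≡a
... | no _    | yes c≡b = inj₂ c≡b
... | no c≢a  | no c≢b  with subst (3 ≤_) ∣S∣≡2 3≤∣S∣
  where
  open ≤-Reasoning
  b∈S-a : b ∈ S - a
  b∈S-a = x∈p∧x≢y⇒x∈p-y b∈S (λ b≡a → a≢b (sym b≡a))
  c∈S-a-b : c ∈ S - a - b
  c∈S-a-b = x∈p∧x≢y⇒x∈p-y (x∈p∧x≢y⇒x∈p-y c∈S c≢a) c≢b
  3≤∣S∣ : 3 ≤ ∣ S ∣
  3≤∣S∣ = begin
    3                                 ≤⟨ s≤s (s≤s (s≤s z≤n)) ⟩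
    suc (suc (suc ∣ S - a - b - c ∣)) ≤⟨ s≤s (s≤s (x∈p⇒∣p-x∣<∣p∣ c∈S-a-b)) ⟩
    suc (suc ∣ S - a - b ∣)           ≤⟨ s≤s (x∈p⇒∣p-x∣<∣p∣ b∈S-a) ⟩
    suc ∣ S - a ∣                     ≤⟨ x∈p⇒∣p-x∣<∣p∣ a∈S ⟩
    ∣ S ∣                             ∎
... | s≤s (s≤s ())

data PunchInView {n} (v : Fin (suc n)) : Fin (suc n) → Set where
  at-v    : PunchInView v v
  punched : ∀ c → PunchInView v (punchIn v c)

punchInView : ∀ (v c : Fin (suc n)) → PunchInView v c
punchInView v c with v ≟ c
... | yes refl = at-v
... | no v≢c   = subst (PunchInView v) (punchIn-punchOut v≢c) (punched (punchOut v≢c))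

module _ {b : Bool} {T : Subset n} (v : Fin (suc n)) where

  punchIn∈insertAt⁺ : ∀ {c} → c ∈ T → punchIn v c ∈ insertAt T v b
  punchIn∈insertAt⁺ {c} c∈T =
    lookup⇒[]= _ _ (trans (insertAt-punchIn T v b c) ([]=⇒lookup c∈T))

  punchIn∈insertAt⁻ : ∀ {c} → punchIn v c ∈ insertAt T v b → c ∈ T
  punchIn∈insertAt⁻ {c} c∈S =
    lookup⇒[]= _ _ (trans (sym (insertAt-punchIn T v b c)) ([]=⇒lookup c∈S))

  v∈insertAt⇒≡true : v ∈ insertAt T v b → b ≡ true
  v∈insertAt⇒≡true v∈S = trans (sym (insertAt-lookup T v b)) ([]=⇒lookup v∈S)

v∉insertAt⇒≡false : ∀ {b} {T : Subset n} v → v ∉ insertAt T v b → b ≡ false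
v∉insertAt⇒≡false {b = false} v _   = refl
v∉insertAt⇒≡false {b = true}  {T} v v∉S =
  ⊥-elim (v∉S (lookup⇒[]= v _ (insertAt-lookup T v true)))

module _ (G : Oriented (suc n)) (v : Fin (suc n)) where

  NeighboursIn : Subset n → Set
  NeighboursIn T = ∀ c → Adjacent G v (punchIn v c) → c ∈ T

  neighboursIn? : ∀ T → Dec (NeighboursIn T)
  neighboursIn? T = all? λ c → adjacent? G v (punchIn v c) →-dec c ∈? T

  CentredBetween : Subset n → Set
  CentredBetween T = ∃₂ λ u w → u ∈ T × w ∈ T × Arc G (punchIn v u) v × Arc G v (punchIn v w)

  convex-insertAt : ∀ {T} b → Convex (delete G v) T →
                    (b ≡ true → NeighboursIn T) → (b ≡ false → ¬ CentredBetween T) →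
                    Convex G (insertAt T v b)
  convex-insertAt {T} b convT closed uncentred u x w u∈S w∈S x∉S (ux , xw) =
    go (punchInView v u) (punchInView v x) (punchInView v w) u∈S w∈S x∉S ux xw
    where
    S : Subset (suc _)
    S = insertAt T v b
    go : ∀ {u x w} → PunchInView v u → PunchInView v x → PunchInView v w →
         u ∈ S → w ∈ S → x ∉ S → Arc G u x → Arc G x w → ⊥
    go at-v        at-v        _           _   _   _   vv _  = irrefl G v vv
    go (punched _) at-v        at-v        _   _   _   _  vv = irrefl G v vv
    go (punched u) at-v        (punched w) u∈S w∈S v∉S uv vw =
      uncentred (v∉insertAt⇒≡false v v∉S)
        (u , w , punchIn∈insertAt⁻ v u∈S , punchIn∈insertAt⁻ v w∈S , uv , vw)
    go at-v        (punched x) _           v∈S _   x∉S vx _  =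
      x∉S (punchIn∈insertAt⁺ v (closed (v∈insertAt⇒≡true v v∈S) x (inj₁ vx)))
    go (punched _) (punched x) at-v        _   v∈S x∉S _  xv =
      x∉S (punchIn∈insertAt⁺ v (closed (v∈insertAt⇒≡true v v∈S) x (inj₂ xv)))
    go (punched u) (punched x) (punched w) u∈S w∈S x∉S ux xw =
      convT u x w (punchIn∈insertAt⁻ v u∈S) (punchIn∈insertAt⁻ v w∈S)
        (λ x∈T → x∉S (punchIn∈insertAt⁺ v x∈T)) (ux , xw)

  degree-2-centred⇒neighboursIn : degree G v ≡ 2 → ∀ {T} → CentredBetween T → NeighboursIn T
  degree-2-centred⇒neighboursIn deg {T} (u , w , u∈T , w∈T , uv , vw) c adj
    with ∣p∣≡2⇒∈-cases deg (adjacent⇒∈neighbours G (inj₂ uv)) (adjacent⇒∈neighbours G (inj₁ vw))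
           u≢w (adjacent⇒∈neighbours G adj)
    where
    u≢w : punchIn v u ≢ punchIn v w
    u≢w u≡w = antisym G v (punchIn v w) vw (subst (λ z → Arc G z v) u≡w uv)
  ... | inj₁ c≡u = subst (_∈ T) (sym (punchIn-injective v c u c≡u)) u∈T
  ... | inj₂ c≡w = subst (_∈ T) (sym (punchIn-injective v c w c≡w)) w∈T

  convex-extension : degree G v ≡ 2 → ∀ {T} → Convex (delete G v) T →
                     ∃ λ b → Convex G (insertAt T v b)
  convex-extension deg {T} convT with neighboursIn? T
  ... | yes closed = true , convex-insertAt true convT (λ _ → closed) λ ()
  ... | no ¬closed = false , convex-insertAt false convT (λ ())
                                 λ _ centred → ¬closed (degree-2-centred⇒neighboursIn deg centred)

pair⊆ : ∀ {x y} {S : Subset n} → x ∈ S → y ∈ S → ⁅ x ⁆ ∪ ⁅ y ⁆ ⊆ S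
pair⊆ {x = x} {y} {S} x∈S y∈S z∈xy with x∈p∪q⁻ ⁅ x ⁆ ⁅ y ⁆ z∈xy
... | inj₁ z∈x = subst (_∈ S) (sym (x∈⁅y⁆⇒x≡y x z∈x)) x∈S
... | inj₂ z∈y = subst (_∈ S) (sym (x∈⁅y⁆⇒x≡y y z∈y)) y∈S

lemma7 : ∀ {n} (G : Oriented (suc n)) (v : Fin (suc n)) →
           degree G v ≡ 2 → CompleteConvex G → CompleteConvex (delete G v)
lemma7 G v deg cc x y xy _ T convT xy⊆T
  with convex-extension G v deg convT
... | b , convS = punchIn∈insertAt⁻ v (cc _ _ xy _ (insertAt T v b) convS (pair⊆ x∈S y∈S))
  where
  x∈S : punchIn v x ∈ insertAt T v b
  x∈S = punchIn∈insertAt⁺ v (xy⊆T (x∈p∪q⁺ (inj₁ (x∈⁅x⁆ x))))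
  y∈S : punchIn v y ∈ insertAt T v b
  y∈S = punchIn∈insertAt⁺ v (xy⊆T (x∈p∪q⁺ (inj₂ (x∈⁅x⁆ y))))
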